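{- Let $p$ be a prime and $a\in\mathbb Z$. Then the equation $z_1^4+z_2^4+3z_3^4+5z_4^4+7z_5^4=a$ has a solution $(z_1,\dots,z_5)\in\mathbb Z_p^5$ in which not all of the variables are zero.
   Context: $\mathbb Z_p$ denotes the ring of $p$-adic integers. -}

module Defs where

open import Data.Nat as ℕ using (ℕ; suc; _^_)
open import Data.Integer using (ℤ; +_; _+_; _-_; _*_)
open import Data.Integer.Divisibility using (_∣_)
open import Data.Fin using (Fin; zero; suc)
open import Relation.Binary.PropositionalEquality using (_≡_)

_≡_[mod_] : ℤ → ℤ → ℕ → Set
x ≡ y [mod m ] = (+ m) ∣ (x - y)

-- p-adic integers as the inverse limit of ℤ/p^k ℤ:
-- a compatible sequence of residues res k ∈ {0,…,p^k - 1}
record ℤₚ (p : ℕ) : Set where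
  field
    res        : ℕ → ℕ
    res-bound  : ∀ k → res k ℕ.< p ^ k
    res-compat : ∀ k → (+ res (suc k)) ≡ (+ res k) [mod (p ^ k) ]
open ℤₚ public

IsZero : ∀ {p} → ℤₚ p → Set
IsZero x = ∀ k → res x k ≡ 0

_⁴ : ℤ → ℤ
x ⁴ = x * x * x * x

form : ∀ {p} → (Fin 5 → ℤₚ p) → ℕ → ℤ
form z k = (r zero) ⁴ + (r (suc zero)) ⁴ + + 3 * (r (suc (suc zero))) ⁴
         + + 5 * (r (suc (suc (suc zero)))) ⁴ + + 7 * (r (suc (suc (suc (suc zero))))) ⁴
  where r : Fin 5 → ℤ
        r i = + res (z i) k

Solves : ∀ {p} → (Fin 5 → ℤₚ p) → ℤ → Set
Solves {p} z a = ∀ k → form z k ≡ a [mod (p ^ k) ]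

-- Hensel's lemma reduces the theorem to a congruence: if some variable zᵢ, with coefficient cᵢ, is
-- a unit and the equation holds modulo p (modulo 32 when p = 2, where the derivative 4cᵢzᵢ³ has
-- 2-adic valuation 2), Newton's iteration in zᵢ converges to a p-adic solution. Starting from
-- zᵢ = 1, we need a - cᵢ to be represented by the other four terms modulo p (resp. 32); for
-- p = 2, 3, 5, 7 this is a finite computation. For p > 7 every residue is x₁⁴ + 3x₂⁴ + 5x₃⁴ + 7x₄⁴:
-- otherwise let Rⱼ be the residues represented by the first j terms. A set containing 0 and closed
-- under adding a unit is everything, so there are sⱼ ∈ Rⱼ₊₁ ∖ Rⱼ for j < 4, and some s₄ ∉ R₄. The
-- Rⱼ are closed under multiplication by fourth powers, so the classes sⱼ·x⁴ (x ≢ 0) are pairwise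
-- disjoint; but the 5(p - 1) > 4p values sⱼx⁴ hit some residue five times, necessarily with the
-- same j, which gives five distinct fourth roots of one residue modulo p.

module Submission where

open import Data.Bool using (if_then_else_)
open import Data.Empty using (⊥; ⊥-elim)
open import Data.Fin as Fin using (Fin; zero; suc; toℕ; fromℕ<; punchIn)
open import Data.Fin.Patterns using (0F; 1F; 2F; 3F; 4F)
open import Data.Fin.Properties using (any?; all?; toℕ-fromℕ<; punchInᵢ≢i)
open import Data.Integer using (ℤ; +_; -[1+_]; _+_; _-_; _*_; -_; ∣_∣; 0ℤ; 1ℤ)
import Data.Integer.Properties as ℤ
open import Data.Integer.DivMod using (_%ℕ_; _/ℕ_; n%ℕd<d; a≡a%ℕn+[a/ℕn]*n)
open import Data.Integer.Divisibility.Signed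
  using (_∣_; divides; _∣?_; ∣ᵤ⇒∣; ∣⇒∣ᵤ; ∣-trans; ∣m∣n⇒∣m+n; ∣m⇒∣-m; ∣m⇒∣m*n; ∣n⇒∣m*n)
open import Data.Integer.Tactic.RingSolver using (solve-∀)
open import Data.List using (List; []; _∷_)
open import Data.Nat as ℕ using (ℕ; zero; suc; _^_; _<_; _≤_; _/_; _%_; NonZero; z≤n; s≤s)
import Data.Nat.Properties as ℕ
import Data.Nat.Divisibility as ℕ
open import Data.Nat.DivMod using (m≡m%n+[m/n]*n; m%n<n; m<n*o⇒m/o<n)
open import Data.Nat.Coprimality using (Coprime; coprime-Bézout)
open import Data.Nat.GCD using (module Bézout)
open import Data.Nat.Primality
  using (Prime; euclidsLemma; prime⇒irreducible; prime⇒nonZero; composite[4]; composite[6]; composite⇒¬prime)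
open import Data.Product as Product using (Σ; ∃; _,_; _×_; proj₁; proj₂)
open import Data.Sum as Sum using (_⊎_; inj₁; inj₂; [_,_]′)
open import Data.Vec using (Vec; lookup; _∷_; [])
import Data.Vec.Functional as Vector
open import Data.Vec.Functional using (updateAt; removeAt)
open import Data.Vec.Functional.Properties using (updateAt-updates; updateAt-minimal)
open import Function using (_∘_; _∘′_; id; const)
open import Function.Definitions using (Injective)
open import Level using (0ℓ)
open import Relation.Binary.Bundles using (Setoid)
open import Relation.Binary.PropositionalEquality
import Relation.Binary.Reasoning.Setoid
open import Relation.Binary.Structures using (IsEquivalence)
open import Relation.Nullary using (¬_; Dec; does; yes; no; ¬?)
open import Relation.Nullary.Decidable using (True; toWitness; map′; _×-dec_; decidable-stable; dec-true; dec-false)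
open import Relation.Unary using (Decidable)
open import Defs

open import Algebra.Properties.CommutativeMonoid.Sum ℤ.+-0-commutativeMonoid using (sum; sum-remove; sum-cong-≗)
open import Algebra.Properties.CommutativeSemigroup ℕ.+-commutativeSemigroup using (interchange)

-- Congruences

-- A record (unlike Defs._≡_[mod_]), so that x, y and m can be inferred from a congruence.
infix 4 _≈_[mod_]
record _≈_[mod_] (x y : ℤ) (m : ℕ) : Set where
  constructor divides-difference
  field divisibility : + m ∣ x - y
open _≈_[mod_] public

module _ {m : ℕ} where

  ≈-reflexive : ∀ {x y} → x ≡ y → x ≈ y [mod m ]
  ≈-reflexive {x} refl = divides-difference (divides 0ℤ (trans (ℤ.+-inverseʳ x) (sym (ℤ.*-zeroˡ (+ m)))))

  ≈-refl : ∀ {x} → x ≈ x [mod m ]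
  ≈-refl = ≈-reflexive refl

  ≈-sym : ∀ {x y} → x ≈ y [mod m ] → y ≈ x [mod m ]
  ≈-sym {x} {y} (divides-difference d) = divides-difference (subst (+ m ∣_) (negate-difference x y) (∣m⇒∣-m d))
    where negate-difference : ∀ x y → - (x - y) ≡ y - x
          negate-difference = solve-∀

  ≈-trans : ∀ {x y z} → x ≈ y [mod m ] → y ≈ z [mod m ] → x ≈ z [mod m ]
  ≈-trans {x} {y} {z} (divides-difference d) (divides-difference e) =
    divides-difference (subst (+ m ∣_) (telescope x y z) (∣m∣n⇒∣m+n d e))
    where telescope : ∀ x y z → (x - y) + (y - z) ≡ x - z
          telescope = solve-∀

  ≈-isEquivalence : IsEquivalence (λ x y → x ≈ y [mod m ])
  ≈-isEquivalence = record { refl = ≈-refl ; sym = ≈-sym ; trans = ≈-trans }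

  +-cong : ∀ {x x' y y'} → x ≈ x' [mod m ] → y ≈ y' [mod m ] → x + y ≈ x' + y' [mod m ]
  +-cong {x} {x'} {y} {y'} (divides-difference d) (divides-difference e) =
    divides-difference (subst (+ m ∣_) (sum-of-differences x x' y y') (∣m∣n⇒∣m+n d e))
    where sum-of-differences : ∀ x x' y y' → (x - x') + (y - y') ≡ (x + y) - (x' + y')
          sum-of-differences = solve-∀

  +-congʳ : ∀ y {x x'} → x ≈ x' [mod m ] → x + y ≈ x' + y [mod m ]
  +-congʳ y x≈x' = +-cong x≈x' (≈-refl {y})

  neg-cong : ∀ {x x'} → x ≈ x' [mod m ] → - x ≈ - x' [mod m ]
  neg-cong {x} {x'} (divides-difference d) = divides-difference (subst (+ m ∣_) (negated x x') (∣m⇒∣-m d))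
    where negated : ∀ x x' → - (x - x') ≡ (- x) - (- x')
          negated = solve-∀

  -‿cong : ∀ {x x' y y'} → x ≈ x' [mod m ] → y ≈ y' [mod m ] → x - y ≈ x' - y' [mod m ]
  -‿cong x≈x' y≈y' = +-cong x≈x' (neg-cong y≈y')

  *-cong : ∀ {x x' y y'} → x ≈ x' [mod m ] → y ≈ y' [mod m ] → x * y ≈ x' * y' [mod m ]
  *-cong {x} {x'} {y} {y'} (divides-difference d) (divides-difference e) =
    divides-difference (subst (+ m ∣_) (product-difference x x' y y') (∣m∣n⇒∣m+n (∣m⇒∣m*n y d) (∣n⇒∣m*n x' e)))
    where product-difference : ∀ x x' y y' → (x - x') * y + x' * (y - y') ≡ x * y - x' * y'
          product-difference = solve-∀

  *-congˡ : ∀ x {y y'} → y ≈ y' [mod m ] → x * y ≈ x * y' [mod m ]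
  *-congˡ x = *-cong (≈-refl {x})

  *-congʳ : ∀ y {x x'} → x ≈ x' [mod m ] → x * y ≈ x' * y [mod m ]
  *-congʳ y x≈x' = *-cong x≈x' (≈-refl {y})

  -‿congˡ : ∀ x {y y'} → y ≈ y' [mod m ] → x - y ≈ x - y' [mod m ]
  -‿congˡ x = -‿cong (≈-refl {x})

  -‿congʳ : ∀ y {x x'} → x ≈ x' [mod m ] → x - y ≈ x' - y [mod m ]
  -‿congʳ y x≈x' = -‿cong x≈x' (≈-refl {y})

  ⁴-cong : ∀ {x x'} → x ≈ x' [mod m ] → x ⁴ ≈ x' ⁴ [mod m ]
  ⁴-cong x≈x' = *-cong (*-cong (*-cong x≈x' x≈x') x≈x') x≈x'

  ∣⇒≈0 : ∀ {x} → + m ∣ x → x ≈ 0ℤ [mod m ]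
  ∣⇒≈0 {x} d = divides-difference (subst (+ m ∣_) (sym (ℤ.+-identityʳ x)) d)

  ≈0⇒∣ : ∀ {x} → x ≈ 0ℤ [mod m ] → + m ∣ x
  ≈0⇒∣ {x} (divides-difference d) = subst (+ m ∣_) (ℤ.+-identityʳ x) d

  ≈⇒≡[mod] : ∀ {x y} → x ≈ y [mod m ] → x ≡ y [mod m ]
  ≈⇒≡[mod] (divides-difference d) = ∣⇒∣ᵤ d

≈-setoid : ℕ → Setoid 0ℓ 0ℓ
≈-setoid m = record { isEquivalence = ≈-isEquivalence {m} }

module ≈-Reasoning (m : ℕ) = Relation.Binary.Reasoning.Setoid (≈-setoid m)

≈-weaken : ∀ {m n x y} → n ℕ.∣ m → x ≈ y [mod m ] → x ≈ y [mod n ]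
≈-weaken n∣m (divides-difference d) = divides-difference (∣-trans (∣ᵤ⇒∣ n∣m) d)

≈-^1 : ∀ {m x y} → x ≈ y [mod m ^ 1 ] → x ≈ y [mod m ]
≈-^1 = ≈-weaken (ℕ.m∣m*n 1)

≈-from-quotient : ∀ {m x y} q → x ≡ y + q * + m → x ≈ y [mod m ]
≈-from-quotient {m} {y = y} q refl = divides-difference (divides q (cancel y q (+ m)))
  where cancel : ∀ y q m → y + q * m - y ≡ q * m
        cancel = solve-∀

%ℕ-≈ : ∀ x m .{{_ : NonZero m}} → + (x %ℕ m) ≈ x [mod m ]
%ℕ-≈ x m = ≈-sym (≈-from-quotient (x /ℕ m) (a≡a%ℕn+[a/ℕn]*n x m))

multiple-<⇒≡0 : ∀ {m} d → d ℕ.< m → m ℕ.∣ d → d ≡ 0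
multiple-<⇒≡0 zero    _   _   = refl
multiple-<⇒≡0 (suc d) d<m m∣d = ⊥-elim (ℕ.>⇒∤ d<m m∣d)

≈-<⇒≤ : ∀ {m a b} → a ℕ.≤ b → b ℕ.< m → + b ≈ + a [mod m ] → b ℕ.≤ a
≈-<⇒≤ {m} {a} {b} a≤b b<m (divides-difference m∣b-a) =
  ℕ.m∸n≡0⇒m≤n (multiple-<⇒≡0 (b ℕ.∸ a) (ℕ.≤-<-trans (ℕ.m∸n≤m b a) b<m) m∣b∸a)
  where m∣b∸a : m ℕ.∣ b ℕ.∸ a
        m∣b∸a = subst (λ d → m ℕ.∣ ∣ d ∣) (trans (ℤ.m-n≡m⊖n b a) (ℤ.⊖-≥ a≤b)) (∣⇒∣ᵤ m∣b-a)

≈-<⇒≡ : ∀ {m a b} → a ℕ.< m → b ℕ.< m → + a ≈ + b [mod m ] → a ≡ b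
≈-<⇒≡ {a = a} {b} a<m b<m a≈b with ℕ.≤-total a b
... | inj₁ a≤b = ℕ.≤-antisym a≤b (≈-<⇒≤ a≤b b<m (≈-sym a≈b))
... | inj₂ b≤a = sym (ℕ.≤-antisym b≤a (≈-<⇒≤ b≤a a<m a≈b))

nonzero-residue : ∀ {m n} → 0 ℕ.< n → n ℕ.< m → ¬ + n ≈ 0ℤ [mod m ]
nonzero-residue {m} {suc n} _ n<m n≈0 = ℕ.1+n≢0 (≈-<⇒≡ n<m (ℕ.≤-<-trans ℕ.z≤n n<m) n≈0)

infix 4 _≈?_[mod_]
_≈?_[mod_] : ∀ x y m → Dec (x ≈ y [mod m ])
x ≈? y [mod m ] = map′ divides-difference divisibility (+ m ∣? x - y)

difference-≈0 : ∀ {m x y} → x ≈ y [mod m ] → x - y ≈ 0ℤ [mod m ]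
difference-≈0 x≈y = ∣⇒≈0 (divisibility x≈y)

≈-from-difference : ∀ {m x y} → x - y ≈ 0ℤ [mod m ] → x ≈ y [mod m ]
≈-from-difference x-y≈0 = divides-difference (≈0⇒∣ x-y≈0)

-- Arithmetic modulo a prime

module _ {p : ℕ} (p-prime : Prime p) where

  ≈0-product : ∀ x y → x * y ≈ 0ℤ [mod p ] → x ≈ 0ℤ [mod p ] ⊎ y ≈ 0ℤ [mod p ]
  ≈0-product x y xy≈0
    with euclidsLemma ∣ x ∣ ∣ y ∣ p-prime (subst (p ℕ.∣_) (ℤ.abs-* x y) (∣⇒∣ᵤ (≈0⇒∣ xy≈0)))
  ... | inj₁ p∣x = inj₁ (∣⇒≈0 (∣ᵤ⇒∣ p∣x))
  ... | inj₂ p∣y = inj₂ (∣⇒≈0 (∣ᵤ⇒∣ p∣y))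

  ≈0-difference-product : ∀ {x y a b} → (x - y) * (a + b) ≈ 0ℤ [mod p ] → x ≈ y [mod p ] ⊎ a ≈ - b [mod p ]
  ≈0-difference-product {x} {y} {a} {b} e =
    Sum.map ≈-from-difference (λ a+b≈0 → ≈-from-difference (≈-trans (≈-reflexive (minus-negation a b)) a+b≈0))
            (≈0-product (x - y) (a + b) e)
    where minus-negation : ∀ a b → a - - b ≡ a + b
          minus-negation = solve-∀

  *-cancelˡ : ∀ {s x y} → ¬ s ≈ 0ℤ [mod p ] → s * x ≈ s * y [mod p ] → x ≈ y [mod p ]
  *-cancelˡ {s} {x} {y} s≉0 sx≈sy =
    [ (λ s≈0 → ⊥-elim (s≉0 s≈0)) , ≈-from-difference ]′
      (≈0-product s (x - y) (≈-trans (≈-reflexive (factor s x y)) (difference-≈0 sx≈sy)))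
    where factor : ∀ s x y → s * (x - y) ≡ s * x - s * y
          factor = solve-∀

  square-roots : ∀ {x y} → x * x ≈ y * y [mod p ] → x ≈ y [mod p ] ⊎ x ≈ - y [mod p ]
  square-roots {x} {y} x²≈y² =
    ≈0-difference-product (≈-trans (≈-reflexive (difference-of-squares x y)) (difference-≈0 x²≈y²))
    where difference-of-squares : ∀ x y → (x - y) * (x + y) ≡ x * x - y * y
          difference-of-squares = solve-∀

  fourth-roots : ∀ {x y} → x ⁴ ≈ y ⁴ [mod p ] → x * x ≈ y * y [mod p ] ⊎ x * x ≈ - (y * y) [mod p ]
  fourth-roots {x} {y} x⁴≈y⁴ =
    ≈0-difference-product (≈-trans (≈-reflexive (difference-of-fourth-powers x y)) (difference-≈0 x⁴≈y⁴))
    where difference-of-fourth-powers : ∀ x y → (x * x - y * y) * (x * x + y * y) ≡ x * x * x * x - y * y * y * y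
          difference-of-fourth-powers = solve-∀

  other-square-root : ∀ {a b} → b * b ≈ a * a [mod p ] → ¬ b ≈ a [mod p ] → b ≈ - a [mod p ]
  other-square-root b²≈a² b≉a = [ ⊥-elim ∘′ b≉a , id ]′ (square-roots b²≈a²)

  other-square-roots-≈ : ∀ {a b c} → b * b ≈ a * a [mod p ] → c * c ≈ a * a [mod p ] →
                         ¬ b ≈ a [mod p ] → ¬ c ≈ a [mod p ] → b ≈ c [mod p ]
  other-square-roots-≈ b²≈a² c²≈a² b≉a c≉a =
    ≈-trans (other-square-root b²≈a² b≉a) (≈-sym (other-square-root c²≈a² c≉a))

  -- x² ≈ ±x₀² for each root x, and three roots on the same side of ± would coincide.
  at-most-four-fourth-roots : (x : Fin 5 → ℤ) → (∀ i j → i ≢ j → ¬ x i ≈ x j [mod p ]) →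
                              (∀ i → x i ⁴ ≈ x zero ⁴ [mod p ]) → ⊥
  at-most-four-fourth-roots x distinct same-fourth-power =
    sides (side 1F) (side 2F) (side 3F) (side 4F)
    where
      Side : Fin 5 → Set
      Side i = x i * x i ≈ x zero * x zero [mod p ] ⊎ x i * x i ≈ - (x zero * x zero) [mod p ]

      side : ∀ i → Side i
      side i = fourth-roots {x i} {x zero} (same-fourth-power i)

      two-on-plus-side : ∀ i j → x i * x i ≈ x zero * x zero [mod p ] → x j * x j ≈ x zero * x zero [mod p ] →
                 zero ≢ i → zero ≢ j → i ≢ j → ⊥
      two-on-plus-side i j i² j² 0≢i 0≢j i≢j =
        distinct i j i≢j (other-square-roots-≈ i² j² (distinct zero i 0≢i ∘′ ≈-sym) (distinct zero j 0≢j ∘′ ≈-sym))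

      three-on-minus-side : ∀ i j k → x i * x i ≈ - (x zero * x zero) [mod p ] → x j * x j ≈ - (x zero * x zero) [mod p ] →
                    x k * x k ≈ - (x zero * x zero) [mod p ] → i ≢ j → i ≢ k → j ≢ k → ⊥
      three-on-minus-side i j k i² j² k² i≢j i≢k j≢k =
        distinct j k j≢k (other-square-roots-≈ (≈-trans j² (≈-sym i²)) (≈-trans k² (≈-sym i²))
                            (λ e → distinct i j i≢j (≈-sym e)) (λ e → distinct i k i≢k (≈-sym e)))

      sides : Side 1F → Side 2F → Side 3F → Side 4F → ⊥
      sides (inj₁ a) (inj₁ b) _        _        = two-on-plus-side 1F 2F a b (λ ()) (λ ()) (λ ())
      sides (inj₁ a) (inj₂ _) (inj₁ b) _        = two-on-plus-side 1F 3F a b (λ ()) (λ ()) (λ ())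
      sides (inj₁ a) (inj₂ _) (inj₂ _) (inj₁ b) = two-on-plus-side 1F 4F a b (λ ()) (λ ()) (λ ())
      sides (inj₁ _) (inj₂ a) (inj₂ b) (inj₂ c) = three-on-minus-side 2F 3F 4F a b c (λ ()) (λ ()) (λ ())
      sides (inj₂ _) (inj₁ a) (inj₁ b) _        = two-on-plus-side 2F 3F a b (λ ()) (λ ()) (λ ())
      sides (inj₂ _) (inj₁ a) (inj₂ _) (inj₁ b) = two-on-plus-side 2F 4F a b (λ ()) (λ ()) (λ ())
      sides (inj₂ a) (inj₁ _) (inj₂ b) (inj₂ c) = three-on-minus-side 1F 3F 4F a b c (λ ()) (λ ()) (λ ())
      sides (inj₂ _) (inj₂ _) (inj₁ a) (inj₁ b) = two-on-plus-side 3F 4F a b (λ ()) (λ ()) (λ ())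
      sides (inj₂ a) (inj₂ b) (inj₁ _) (inj₂ c) = three-on-minus-side 1F 2F 4F a b c (λ ()) (λ ()) (λ ())
      sides (inj₂ a) (inj₂ b) (inj₂ c) _        = three-on-minus-side 1F 2F 3F a b c (λ ()) (λ ()) (λ ())

  coprime-to-prime : ∀ {x} → ¬ x ≈ 0ℤ [mod p ] → Coprime ∣ x ∣ p
  coprime-to-prime x≉0 (d∣x , d∣p) with prime⇒irreducible p-prime d∣p
  ... | inj₁ d≡1 = d≡1
  ... | inj₂ refl = ⊥-elim (x≉0 (∣⇒≈0 (∣ᵤ⇒∣ d∣x)))

  bézout⇒inverse : ∀ {n} → Bézout.Identity 1 n p → Σ ℤ λ u → + n * u ≈ 1ℤ [mod p ]
  bézout⇒inverse {n} (Bézout.+- a b eq) = + a , ≈-from-quotient (+ b) (begin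
    + n * + a           ≡⟨ sym (ℤ.pos-* n a) ⟩
    + (n ℕ.* a)         ≡⟨ cong +_ (trans (ℕ.*-comm n a) (sym eq)) ⟩
    + (1 ℕ.+ b ℕ.* p)   ≡⟨ ℤ.pos-+ 1 (b ℕ.* p) ⟩
    1ℤ + + (b ℕ.* p)    ≡⟨ cong (λ t → 1ℤ + t) (ℤ.pos-* b p) ⟩
    1ℤ + + b * + p      ∎)
    where open ≡-Reasoning
  bézout⇒inverse {n} (Bézout.-+ a b eq) = - + a , ≈-from-quotient (- + b) (begin
    + n * - + a               ≡⟨ negated (+ n) (+ a) ⟩
    1ℤ - (1ℤ + + a * + n)     ≡⟨ cong (λ t → 1ℤ - (1ℤ + t)) (sym (ℤ.pos-* a n)) ⟩
    1ℤ - (1ℤ + + (a ℕ.* n))   ≡⟨ cong (λ t → 1ℤ - t) (sym (ℤ.pos-+ 1 (a ℕ.* n))) ⟩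
    1ℤ - + (1 ℕ.+ a ℕ.* n)    ≡⟨ cong (λ t → 1ℤ - + t) eq ⟩
    1ℤ - + (b ℕ.* p)          ≡⟨ cong (λ t → 1ℤ - t) (ℤ.pos-* b p) ⟩
    1ℤ - + b * + p            ≡⟨ negated-quotient (+ b) (+ p) ⟩
    1ℤ + - + b * + p          ∎)
    where open ≡-Reasoning
          negated : ∀ n a → n * - a ≡ 1ℤ - (1ℤ + a * n)
          negated = solve-∀
          negated-quotient : ∀ b p → 1ℤ - b * p ≡ 1ℤ + - b * p
          negated-quotient = solve-∀

  inverse-ℕ : ∀ {n} → ¬ + n ≈ 0ℤ [mod p ] → Σ ℤ λ u → + n * u ≈ 1ℤ [mod p ]
  inverse-ℕ n≉0 = bézout⇒inverse (coprime-Bézout (coprime-to-prime n≉0))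

  inverse : ∀ {x} → ¬ x ≈ 0ℤ [mod p ] → Σ ℤ λ u → x * u ≈ 1ℤ [mod p ]
  inverse { + n } x≉0 = inverse-ℕ x≉0
  inverse { -[1+ n ]} x≉0 =
    Product.map -_ (≈-trans (≈-reflexive (negate-both (+ suc n) _))) (inverse-ℕ (x≉0 ∘′ neg-cong))
    where negate-both : ∀ a u → - a * - u ≡ a * u
          negate-both = solve-∀

-- A generalised pigeonhole principle

count : ∀ {P : ℕ → Set} → Decidable P → ℕ → ℕ
count P? zero    = 0
count P? (suc n) = (if does (P? n) then 1 else 0) ℕ.+ count P? n

sumBelow : (ℕ → ℕ) → ℕ → ℕ
sumBelow g zero    = 0
sumBelow g (suc m) = g m ℕ.+ sumBelow g m

module _ {P : ℕ → Set} (P? : Decidable P) where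

  last-witness : ∀ {k} N → suc k ≤ count P? N → ∃ λ n → n < N × P n × k ≤ count P? n
  last-witness (suc N) k<count with P? N
  ... | yes pN = N , ℕ.n<1+n N , pN , ℕ.s≤s⁻¹ k<count
  ... | no _ with last-witness N k<count
  ...   | n , n<N , pn , k≤count = n , ℕ.m<n⇒m<1+n n<N , pn , k≤count

  count-witnesses : ∀ k N → k ≤ count P? N →
                    Σ (Fin k → ℕ) λ s → Injective _≡_ _≡_ s × (∀ i → s i < N × P (s i))
  count-witnesses zero    N _ = (λ ()) , (λ { {()} }) , λ ()
  count-witnesses (suc k) N k<count with last-witness N k<count
  ... | n , n<N , pn , k≤count with count-witnesses k n k≤count
  ...   | s , s-injective , s-bounded = witnesses , injective , bounded
    where
      witnesses : Fin (suc k) → ℕ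
      witnesses zero    = n
      witnesses (suc i) = s i

      bounded : ∀ i → witnesses i < N × P (witnesses i)
      bounded zero    = n<N , pn
      bounded (suc i) = ℕ.<-trans (proj₁ (s-bounded i)) n<N , proj₂ (s-bounded i)

      injective : Injective _≡_ _≡_ witnesses
      injective {zero}  {zero}  _ = refl
      injective {zero}  {suc j} n≡sj = ⊥-elim (ℕ.<-irrefl (sym n≡sj) (proj₁ (s-bounded j)))
      injective {suc i} {zero}  si≡n = ⊥-elim (ℕ.<-irrefl si≡n (proj₁ (s-bounded i)))
      injective {suc i} {suc j} si≡sj = cong suc (s-injective si≡sj)

sumBelow-+ : ∀ g h m → sumBelow (λ y → g y ℕ.+ h y) m ≡ sumBelow g m ℕ.+ sumBelow h m
sumBelow-+ g h zero    = refl
sumBelow-+ g h (suc m) rewrite sumBelow-+ g h m = interchange (g m) (h m) (sumBelow g m) (sumBelow h m)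

sumBelow-≤ : ∀ {g k} m → (∀ y → y < m → g y ≤ k) → sumBelow g m ≤ m ℕ.* k
sumBelow-≤ zero    _      = z≤n
sumBelow-≤ (suc m) g≤k = ℕ.+-mono-≤ (g≤k m (ℕ.n<1+n m)) (sumBelow-≤ m (λ y y<m → g≤k y (ℕ.m<n⇒m<1+n y<m)))

indicator-sum-above : ∀ c m → m ≤ c → sumBelow (λ y → if does (c ℕ.≟ y) then 1 else 0) m ≡ 0
indicator-sum-above c zero    _   = refl
indicator-sum-above c (suc m) m<c
  rewrite dec-false (c ℕ.≟ m) (λ c≡m → ℕ.<-irrefl (sym c≡m) m<c) = indicator-sum-above c m (ℕ.<⇒≤ m<c)

indicator-sum : ∀ c m → c < m → sumBelow (λ y → if does (c ℕ.≟ y) then 1 else 0) m ≡ 1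
indicator-sum c (suc m) c<1+m with c ℕ.≟ m
... | yes refl rewrite dec-true (c ℕ.≟ c) refl = cong suc (indicator-sum-above c c ℕ.≤-refl)
... | no c≢m rewrite dec-false (c ℕ.≟ m) c≢m = indicator-sum c m (ℕ.≤∧≢⇒< (ℕ.s≤s⁻¹ c<1+m) c≢m)

fibre-sizes-sum : ∀ (f : ℕ → ℕ) m N → (∀ n → n < N → f n < m) →
                  sumBelow (λ y → count (λ n → f n ℕ.≟ y) N) m ≡ N
fibre-sizes-sum f m zero    _ = zeros m
  where zeros : ∀ m → sumBelow (λ _ → 0) m ≡ 0
        zeros zero    = refl
        zeros (suc m) = zeros m
fibre-sizes-sum f m (suc N) f<m = begin
  sumBelow (λ y → count (λ n → f n ℕ.≟ y) (suc N)) m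
    ≡⟨ sumBelow-+ (λ y → if does (f N ℕ.≟ y) then 1 else 0) (λ y → count (λ n → f n ℕ.≟ y) N) m ⟩
  sumBelow (λ y → if does (f N ℕ.≟ y) then 1 else 0) m ℕ.+ sumBelow (λ y → count (λ n → f n ℕ.≟ y) N) m
    ≡⟨ cong₂ ℕ._+_ (indicator-sum (f N) m (f<m N (ℕ.n<1+n N)))
                   (fibre-sizes-sum f m N (λ n n<N → f<m n (ℕ.m<n⇒m<1+n n<N))) ⟩
  suc N ∎
  where open ≡-Reasoning

pigeonhole : ∀ (f : ℕ → ℕ) {m N} k → (∀ n → n < N → f n < m) → m ℕ.* k < N →
             ∃ λ y → Σ (Fin (suc k) → ℕ) λ s → Injective _≡_ _≡_ s × (∀ i → s i < N × f (s i) ≡ y)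
pigeonhole f {m} {N} k f<m mk<N with ℕ.anyUpTo? (λ y → k ℕ.<? count (λ n → f n ℕ.≟ y) N) m
... | yes (y , _ , k<count) = y , count-witnesses (λ n → f n ℕ.≟ y) (suc k) N k<count
... | no no-large-fibre = ⊥-elim (ℕ.<⇒≱ mk<N (begin
  N                                            ≡⟨ sym (fibre-sizes-sum f m N f<m) ⟩
  sumBelow (λ y → count (λ n → f n ℕ.≟ y) N) m ≤⟨ sumBelow-≤ m (λ y y<m → ℕ.≮⇒≥ (λ k<count → no-large-fibre (y , y<m , k<count))) ⟩
  m ℕ.* k                                      ∎))
  where open ℕ.≤-Reasoning

-- Residues represented by diagonal quartic forms modulo a prime

prefix : (ℕ → ℤ) → ℕ → List ℤ
prefix c zero    = []
prefix c (suc j) = c j ∷ prefix c j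

module _ {p : ℕ} (p-prime : Prime p) where

  private instance
    p-nonZero : NonZero p
    p-nonZero = prime⇒nonZero p-prime

  reduce : ℤ → Fin p
  reduce z = fromℕ< (n%ℕd<d z p)

  reduce-≈ : ∀ z → + toℕ (reduce z) ≈ z [mod p ]
  reduce-≈ z = subst (λ r → + r ≈ z [mod p ]) (sym (toℕ-fromℕ< (n%ℕd<d z p))) (%ℕ-≈ z p)

  -- The witnesses range over Fin p so that representability is decidable.
  Represented : List ℤ → ℤ → Set
  Represented []       t = t ≈ 0ℤ [mod p ]
  Represented (c ∷ cs) t = Σ (Fin p) λ x → Represented cs (t - c * (+ toℕ x) ⁴)

  represented? : ∀ cs t → Dec (Represented cs t)
  represented? []       t = map′ ∣⇒≈0 ≈0⇒∣ (+ p ∣? t)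
  represented? (c ∷ cs) t = any? λ x → represented? cs (t - c * (+ toℕ x) ⁴)

  represented-resp : ∀ cs {t t'} → t ≈ t' [mod p ] → Represented cs t → Represented cs t'
  represented-resp []       t≈t' t≈0    = ≈-trans (≈-sym t≈t') t≈0
  represented-resp (c ∷ cs) t≈t' (x , r) = x , represented-resp cs (-‿congʳ (c * (+ toℕ x) ⁴) t≈t') r

  represented-∷ : ∀ c cs t z → Represented cs (t - c * z ⁴) → Represented (c ∷ cs) t
  represented-∷ c cs t z r =
    reduce z , represented-resp cs (-‿congˡ t (*-congˡ c (⁴-cong (≈-sym (reduce-≈ z))))) r

  represented-∷-≡ : ∀ c cs t z {s} → t - c * z ⁴ ≡ s → Represented cs s → Represented (c ∷ cs) t
  represented-∷-≡ c cs t z eq r = represented-∷ c cs t z (subst (Represented cs) (sym eq) r)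

  represented-0 : ∀ cs → Represented cs 0ℤ
  represented-0 []       = ≈-refl
  represented-0 (c ∷ cs) = represented-∷-≡ c cs 0ℤ 0ℤ (minus-zero c) (represented-0 cs)
    where minus-zero : ∀ c → 0ℤ - c * (0ℤ * 0ℤ * 0ℤ * 0ℤ) ≡ 0ℤ
          minus-zero = solve-∀

  represented-weaken : ∀ c cs {t} → Represented cs t → Represented (c ∷ cs) t
  represented-weaken c cs {t} = represented-∷-≡ c cs t 0ℤ (minus-zero t c)
    where minus-zero : ∀ t c → t - c * (0ℤ * 0ℤ * 0ℤ * 0ℤ) ≡ t
          minus-zero = solve-∀

  represented-shift : ∀ c cs {s} → Represented cs s → Represented (c ∷ cs) (s + c)
  represented-shift c cs {s} = represented-∷-≡ c cs (s + c) 1ℤ (minus-one s c)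
    where minus-one : ∀ s c → s + c - c * (1ℤ * 1ℤ * 1ℤ * 1ℤ) ≡ s
          minus-one = solve-∀

  represented-*⁴ : ∀ cs t w → Represented cs t → Represented cs (t * w ⁴)
  represented-*⁴ []       t w t≈0     = ≈-trans (*-congʳ (w ⁴) t≈0) (≈-reflexive (ℤ.*-zeroˡ (w ⁴)))
  represented-*⁴ (c ∷ cs) t w (x , r) =
    represented-∷-≡ c cs (t * w ⁴) (+ toℕ x * w) (scale t c (+ toℕ x) w) (represented-*⁴ cs _ w r)
    where scale : ∀ t c x w → t * (w * w * w * w) - c * ((x * w) * (x * w) * (x * w) * (x * w))
                              ≡ (t - c * (x * x * x * x)) * (w * w * w * w)
          scale = solve-∀

  -- Closure under adding the unit c makes the set contain every multiple of c.
  closed⇒represented : ∀ c cs → ¬ c ≈ 0ℤ [mod p ] →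
                       (∀ {s} → Represented (c ∷ cs) s → Represented cs s) → ∀ t → Represented cs t
  closed⇒represented c cs c≉0 closed t =
    represented-resp cs (≈-trans (*-congʳ c (%ℕ-≈ (t * u) p)) t*u*c≈t) (multiples ((t * u) %ℕ p))
    where
      u : ℤ
      u = proj₁ (inverse p-prime c≉0)

      t*u*c≈t : t * u * c ≈ t [mod p ]
      t*u*c≈t = begin
        t * u * c    ≡⟨ reassociate t u c ⟩
        t * (c * u)  ≈⟨ *-congˡ t (proj₂ (inverse p-prime c≉0)) ⟩
        t * 1ℤ       ≡⟨ ℤ.*-identityʳ t ⟩
        t            ∎
        where open ≈-Reasoning p
              reassociate : ∀ t u c → t * u * c ≡ t * (c * u)
              reassociate = solve-∀

      multiples : ∀ n → Represented cs (+ n * c)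
      multiples zero    = subst (Represented cs) (sym (ℤ.*-zeroˡ c)) (represented-0 cs)
      multiples (suc n) = subst (Represented cs) (successor (+ n) c) (closed (represented-shift c cs (multiples n)))
        where successor : ∀ n c → n * c + c ≡ (1ℤ + n) * c
              successor = solve-∀

  module _ (c : ℕ → ℤ) (c-unit : ∀ j → j < 4 → ¬ c j ≈ 0ℤ [mod p ]) where

    private
      R : ℕ → ℤ → Set
      R j = Represented (prefix c j)

    R-≤ : ∀ {i j s} → i ≤ j → R i s → R j s
    R-≤ {i} {s = s} i≤j = go (ℕ.≤⇒≤′ i≤j)
      where go : ∀ {j} → i ℕ.≤′ j → R i s → R j s
            go ℕ.≤′-refl        r = r
            go {suc j} (ℕ.≤′-step i≤′j) r = represented-weaken (c j) (prefix c j) (go i≤′j r)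

    module Unrepresented (5<p : 5 < p) (t : ℤ) (t∉R₄ : ¬ R 4 t) where

      new-element : ∀ j → j < 4 → Σ ℤ λ s → R (suc j) s × ¬ R j s
      new-element j j<4
        with any? (λ (s : Fin p) → represented? (prefix c (suc j)) (+ toℕ s) ×-dec ¬? (represented? (prefix c j) (+ toℕ s)))
      ... | yes (s , s∈ , s∉) = + toℕ s , s∈ , s∉
      ... | no none = ⊥-elim (t∉R₄ (R-≤ (ℕ.<⇒≤ j<4) (closed⇒represented (c j) (prefix c j) (c-unit j j<4) closed t)))
        where closed : ∀ {s} → R (suc j) s → R j s
              closed {s} s∈ = decidable-stable (represented? (prefix c j) s) λ s∉ →
                none (reduce s , represented-resp (prefix c (suc j)) (≈-sym (reduce-≈ s)) s∈ ,
                      s∉ ∘ represented-resp (prefix c j) (reduce-≈ s))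

      element : ℕ → ℤ
      element j with j ℕ.<? 4
      ... | yes j<4 = proj₁ (new-element j j<4)
      ... | no _    = t

      element-∈ : ∀ i → i < 4 → R (suc i) (element i)
      element-∈ i i<4 with i ℕ.<? 4
      ... | yes i<4′ = proj₁ (proj₂ (new-element i i<4′))
      ... | no i≮4 = ⊥-elim (i≮4 i<4)

      element-∉ : ∀ i → i ≤ 4 → ¬ R i (element i)
      element-∉ i i≤4 with i ℕ.<? 4
      ... | yes i<4 = proj₂ (proj₂ (new-element i i<4))
      ... | no i≮4 rewrite ℕ.≤∧≮⇒≡ i≤4 i≮4 = t∉R₄

      element-unit : ∀ i → i ≤ 4 → ¬ element i ≈ 0ℤ [mod p ]
      element-unit i i≤4 e≈0 = element-∉ i i≤4 (R-≤ z≤n e≈0)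

      disjoint : ∀ {i j} x y → i < j → j ≤ 4 → ¬ y ≈ 0ℤ [mod p ] →
                 ¬ element i * x ⁴ ≈ element j * y ⁴ [mod p ]
      disjoint {i} {j} x y i<j j≤4 y≉0 e =
        element-∉ j j≤4 (R-≤ i<j (represented-resp (prefix c (suc i)) scaled≈
          (represented-*⁴ (prefix c (suc i)) (element i) (x * v) (element-∈ i (ℕ.<-≤-trans i<j j≤4)))))
        where
          v : ℤ
          v = proj₁ (inverse p-prime y≉0)
          scaled≈ : element i * (x * v) ⁴ ≈ element j [mod p ]
          scaled≈ = begin
            element i * (x * v) ⁴        ≡⟨ pull-out (element i) x v ⟩
            element i * x ⁴ * v ⁴        ≈⟨ *-congʳ (v ⁴) e ⟩
            element j * y ⁴ * v ⁴        ≡⟨ sym (pull-out (element j) y v) ⟩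
            element j * (y * v) ⁴        ≈⟨ *-congˡ (element j) (⁴-cong (proj₂ (inverse p-prime y≉0))) ⟩
            element j * 1ℤ ⁴             ≡⟨ ℤ.*-identityʳ (element j) ⟩
            element j                    ∎
            where open ≈-Reasoning p
                  pull-out : ∀ a x v → a * ((x * v) * (x * v) * (x * v) * (x * v)) ≡ a * (x * x * x * x) * (v * v * v * v)
                  pull-out = solve-∀

      -- Count the pairs (j , x) with j ≤ 4 and x a nonzero residue, encoded as n ↦ (n / d , 1 + n % d).
      d : ℕ
      d = ℕ.pred p

      p≡1+d : p ≡ suc d
      p≡1+d = sym (ℕ.suc-pred p)

      4<d : 4 < d
      4<d = ℕ.≤-pred (subst (5 <_) p≡1+d 5<p)

      private instance
        d-nonZero : NonZero d
        d-nonZero = ℕ.>-nonZero (ℕ.<-trans (s≤s z≤n) 4<d)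

      level : ℕ → ℕ
      level n = n / d

      root : ℕ → ℤ
      root n = + suc (n % d)

      image : ℕ → ℕ
      image n = (element (level n) * root n ⁴) %ℕ p

      level≤4 : ∀ {n} → n < 5 ℕ.* d → level n ≤ 4
      level≤4 n<5d = ℕ.≤-pred (m<n*o⇒m/o<n n<5d)

      root<p : ∀ n → suc (n % d) < p
      root<p n = subst (suc (n % d) <_) (sym p≡1+d) (s≤s (m%n<n n d))

      root-unit : ∀ n → ¬ root n ≈ 0ℤ [mod p ]
      root-unit n = nonzero-residue (s≤s z≤n) (root<p n)

      domain-large : p ℕ.* 4 < 5 ℕ.* d
      domain-large = begin-strict
        p ℕ.* 4        ≡⟨ cong (ℕ._* 4) p≡1+d ⟩
        4 ℕ.+ d ℕ.* 4  <⟨ ℕ.+-monoˡ-< (d ℕ.* 4) 4<d ⟩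
        d ℕ.+ d ℕ.* 4  ≡⟨ cong (d ℕ.+_) (ℕ.*-comm d 4) ⟩
        5 ℕ.* d        ∎
        where open ℕ.≤-Reasoning

      large-fibre : ∃ λ y → Σ (Fin 5 → ℕ) λ s → Injective _≡_ _≡_ s × (∀ i → s i < 5 ℕ.* d × image (s i) ≡ y)
      large-fibre = pigeonhole image 4 (λ n _ → n%ℕd<d (element (level n) * root n ⁴) p) domain-large

      fibre : Fin 5 → ℕ
      fibre = proj₁ (proj₂ large-fibre)

      fibre-injective : Injective _≡_ _≡_ fibre
      fibre-injective = proj₁ (proj₂ (proj₂ large-fibre))

      fibre-level≤4 : ∀ i → level (fibre i) ≤ 4
      fibre-level≤4 i = level≤4 (proj₁ (proj₂ (proj₂ (proj₂ large-fibre)) i))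

      same-image : ∀ i j → image (fibre i) ≡ image (fibre j)
      same-image i j = trans (fibre-image i) (sym (fibre-image j))
        where fibre-image : ∀ i → image (fibre i) ≡ proj₁ large-fibre
              fibre-image = proj₂ ∘ proj₂ (proj₂ (proj₂ large-fibre))

      fibre-≈ : ∀ i j → element (level (fibre i)) * root (fibre i) ⁴ ≈ element (level (fibre j)) * root (fibre j) ⁴ [mod p ]
      fibre-≈ i j = begin
        element (level (fibre i)) * root (fibre i) ⁴  ≈⟨ %ℕ-≈ _ p ⟨
        + image (fibre i)                              ≡⟨ cong +_ (same-image i j) ⟩
        + image (fibre j)                              ≈⟨ %ℕ-≈ _ p ⟩
        element (level (fibre j)) * root (fibre j) ⁴  ∎
        where open ≈-Reasoning p

      same-level : ∀ i j → level (fibre i) ≡ level (fibre j)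
      same-level i j = ℕ.≤-antisym (ℕ.≮⇒≥ (different-levels j i)) (ℕ.≮⇒≥ (different-levels i j))
        where different-levels : ∀ i j → ¬ level (fibre i) < level (fibre j)
              different-levels i j i<j =
                disjoint (root (fibre i)) (root (fibre j)) i<j (fibre-level≤4 j) (root-unit (fibre j)) (fibre-≈ i j)

      same-fourth-power : ∀ i j → root (fibre i) ⁴ ≈ root (fibre j) ⁴ [mod p ]
      same-fourth-power i j = *-cancelˡ p-prime (element-unit _ (fibre-level≤4 i))
        (subst (λ l → element (level (fibre i)) * root (fibre i) ⁴ ≈ element l * root (fibre j) ⁴ [mod p ])
               (sym (same-level i j)) (fibre-≈ i j))

      distinct-roots : ∀ i j → i ≢ j → ¬ root (fibre i) ≈ root (fibre j) [mod p ]
      distinct-roots i j i≢j roots≈ = i≢j (fibre-injective (begin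
        fibre i                                   ≡⟨ m≡m%n+[m/n]*n (fibre i) d ⟩
        fibre i % d ℕ.+ level (fibre i) ℕ.* d     ≡⟨ cong₂ (λ r l → r ℕ.+ l ℕ.* d) same-remainder (same-level i j) ⟩
        fibre j % d ℕ.+ level (fibre j) ℕ.* d     ≡⟨ sym (m≡m%n+[m/n]*n (fibre j) d) ⟩
        fibre j                                   ∎))
        where open ≡-Reasoning
              same-remainder : fibre i % d ≡ fibre j % d
              same-remainder = ℕ.suc-injective (≈-<⇒≡ (root<p (fibre i)) (root<p (fibre j)) roots≈)

      absurd : ⊥
      absurd = at-most-four-fourth-roots p-prime (root ∘ fibre) distinct-roots (λ i → same-fourth-power i zero)

    every-residue-represented : 5 < p → ∀ t → Represented (prefix c 4) t
    every-residue-represented 5<p t = decidable-stable (represented? (prefix c 4) t) (Unrepresented.absurd 5<p t)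

  represented-by-residues : ∀ cs → (∀ (r : Fin p) → Represented cs (+ toℕ r)) → ∀ t → Represented cs t
  represented-by-residues cs represented t = represented-resp cs (reduce-≈ t) (represented (reduce t))

-- p-adic integers as limits of compatible sequences

module _ (p : ℕ) .{{_ : NonZero p}} where

  p^k-nonZero : ∀ k → NonZero (p ^ k)
  p^k-nonZero k = ℕ.m^n≢0 p k

  residue : ℤ → ℕ → ℕ
  residue x k = _%ℕ_ x (p ^ k) {{p^k-nonZero k}}

  residue-≈ : ∀ x k → + residue x k ≈ x [mod p ^ k ]
  residue-≈ x k = %ℕ-≈ x (p ^ k) {{p^k-nonZero k}}

  Compatible : (ℕ → ℤ) → Set
  Compatible x = ∀ k → x (suc k) ≈ x k [mod p ^ k ]

  fromCompatible : (x : ℕ → ℤ) → Compatible x → ℤₚ p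
  fromCompatible x compatible = record
    { res        = λ k → residue (x k) k
    ; res-bound  = λ k → n%ℕd<d (x k) (p ^ k) {{p^k-nonZero k}}
    ; res-compat = ≈⇒≡[mod] ∘ residues-compatible
    }
    where
      residues-compatible : ∀ k → + residue (x (suc k)) (suc k) ≈ + residue (x k) k [mod p ^ k ]
      residues-compatible k = begin
        + residue (x (suc k)) (suc k) ≈⟨ ≈-weaken (ℕ.n∣m*n p) (residue-≈ (x (suc k)) (suc k)) ⟩
        x (suc k)                     ≈⟨ compatible k ⟩
        x k                           ≈⟨ residue-≈ (x k) k ⟨
        + residue (x k) k             ∎
        where open ≈-Reasoning (p ^ k)

  res-fromCompatible : ∀ x compatible k → + res (fromCompatible x compatible) k ≈ x k [mod p ^ k ]
  res-fromCompatible x _ k = residue-≈ (x k) k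

  fromℤ : ℤ → ℤₚ p
  fromℤ n = fromCompatible (λ _ → n) (λ _ → ≈-refl)

  res-fromℤ : ∀ n k → + res (fromℤ n) k ≈ n [mod p ^ k ]
  res-fromℤ n = res-fromCompatible (λ _ → n) (λ _ → ≈-refl)

  ≉0⇒¬IsZero : ∀ (x : ℤₚ p) {u} → + res x 1 ≈ u [mod p ] → ¬ u ≈ 0ℤ [mod p ] → ¬ IsZero x
  ≉0⇒¬IsZero x x₁≈u u≉0 x≡0 = u≉0 (≈-trans (≈-sym x₁≈u) (≈-reflexive (cong +_ (x≡0 1))))

-- Hensel's lemma for γ x⁴ = c

iterate-with-invariant : ∀ {A : Set} (P : ℕ → A → Set) (R : ℕ → A → A → Set) {a} → P 0 a →
                         (∀ k {x} → P k x → Σ A λ y → P (suc k) y × R k y x) →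
                         Σ (ℕ → A) λ s → (∀ k → P k (s k)) × (∀ k → R k (s (suc k)) (s k))
iterate-with-invariant {A} P R {a} P₀ step = proj₁ ∘ go , proj₂ ∘ go , λ k → proj₂ (proj₂ (step k (proj₂ (go k))))
  where go : ∀ k → Σ A (P k)
        go zero    = a , P₀
        go (suc k) = Product.map₂ proj₁ (step k (proj₂ (go k)))

quartic-taylor : ∀ γ x h e → (γ * (x * x * x * x) + e) - γ * ((x + h) * (x + h) * (x + h) * (x + h))
                             ≡ e - + 4 * γ * (x * x * x) * h - γ * (h * h) * (+ 6 * x * x + + 4 * x * h + h * h)
quartic-taylor = solve-∀

-- At x ≈ 1 the derivative 4γx³ = D · Eγx³ is D times a unit with inverse u modulo m:
-- D = 1 when 4 is invertible modulo m, and D = 4 when m = 2.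
module _ (m : ℕ) .{{_ : NonZero m}} (D : ℕ) {γ c u E : ℤ}
         (D*E≡4 : + D * E ≡ + 4) (E*γ*u≈1 : E * γ * u ≈ 1ℤ [mod m ]) where

  Approximation : ℕ → ℤ → Set
  Approximation k x = γ * x ⁴ ≈ c [mod D ℕ.* D ℕ.* m ^ suc k ] × x ≈ 1ℤ [mod m ]

  -- Newton's step x ↦ x + u (c - γx⁴) / D; the division is exact because D² divides c - γx⁴.
  newton-step : ∀ k {x} → Approximation k x →
                Σ ℤ λ x' → Approximation (suc k) x' × x' ≈ x [mod D ℕ.* m ^ suc k ]
  newton-step k {x} (γx⁴≈c , x≈1) = x + h , (γx'⁴≈c , x'≈1) , x'≈x
    where
      D' m' M K : ℤ
      D' = + D
      m' = + m
      M  = + (m ^ suc k)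
      K  = + (m ^ k)

      cast₁ : + (D ℕ.* m ^ suc k) ≡ D' * M
      cast₁ = ℤ.pos-* D (m ^ suc k)

      cast₂ : + (D ℕ.* D ℕ.* m ^ suc k) ≡ D' * D' * M
      cast₂ = trans (ℤ.pos-* (D ℕ.* D) (m ^ suc k)) (cong (_* M) (ℤ.pos-* D D))

      cast₃ : + (D ℕ.* D ℕ.* m ^ suc (suc k)) ≡ D' * D' * (m' * M)
      cast₃ = trans (ℤ.pos-* (D ℕ.* D) (m ^ suc (suc k))) (cong₂ _*_ (ℤ.pos-* D D) (ℤ.pos-* m (m ^ suc k)))

      q : ℤ
      q = _∣_.quotient (divisibility (≈-sym γx⁴≈c))

      c≡ : c ≡ γ * x ⁴ + q * (D' * D' * M)
      c≡ = trans (split c (γ * x ⁴))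
                 (cong (γ * x ⁴ +_) (trans (_∣_.equality (divisibility (≈-sym γx⁴≈c))) (cong (q *_) cast₂)))
        where split : ∀ c t → c ≡ t + (c - t)
              split = solve-∀

      h : ℤ
      h = u * q * (D' * M)

      x'≈x : x + h ≈ x [mod D ℕ.* m ^ suc k ]
      x'≈x = ≈-from-quotient (u * q) (cong (λ t → x + u * q * t) (sym cast₁))

      x'≈1 : x + h ≈ 1ℤ [mod m ]
      x'≈1 = ≈-trans (≈-weaken (ℕ.∣n⇒∣m*n D (ℕ.m∣m*n (m ^ k))) x'≈x) x≈1

      derivative-unit : E * γ * (x * x * x) * u ≈ 1ℤ [mod m ]
      derivative-unit = begin
        E * γ * (x * x * x) * u    ≈⟨ *-congʳ u (*-congˡ (E * γ) (*-cong (*-cong x≈1 x≈1) x≈1)) ⟩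
        E * γ * (1ℤ * 1ℤ * 1ℤ) * u ≡⟨ drop-ones E γ u ⟩
        E * γ * u                  ≈⟨ E*γ*u≈1 ⟩
        1ℤ                         ∎
        where open ≈-Reasoning m
              drop-ones : ∀ E γ u → E * γ * (1ℤ * 1ℤ * 1ℤ) * u ≡ E * γ * u
              drop-ones = solve-∀

      r : ℤ
      r = _∣_.quotient (divisibility (≈-sym derivative-unit))

      W Q : ℤ
      W = + 6 * x * x + + 4 * x * h + h * h
      Q = q * r - γ * u * u * q * q * W * K

      c-γx'⁴ : c - γ * (x + h) ⁴ ≡ Q * (D' * D' * (m' * M))
      c-γx'⁴ = begin
        c - γ * (x + h) ⁴
          ≡⟨ cong (λ t → t - γ * (x + h) ⁴) c≡ ⟩
        (γ * x ⁴ + q * (D' * D' * M)) - γ * (x + h) ⁴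
          ≡⟨ quartic-taylor γ x h _ ⟩
        q * (D' * D' * M) - + 4 * γ * (x * x * x) * h - γ * (h * h) * W
          ≡⟨ cong (λ f → q * (D' * D' * M) - f * γ * (x * x * x) * h - γ * (h * h) * W) (sym D*E≡4) ⟩
        q * (D' * D' * M) - D' * E * γ * (x * x * x) * h - γ * (h * h) * W
          ≡⟨ regroup q D' M E γ x u W ⟩
        q * D' * D' * M * (1ℤ - E * γ * (x * x * x) * u) - γ * u * u * q * q * W * M * (D' * D' * M)
          ≡⟨ cong₂ (λ t N → q * D' * D' * M * t - γ * u * u * q * q * W * N * (D' * D' * M))
                   (_∣_.equality (divisibility (≈-sym derivative-unit))) (ℤ.pos-* m (m ^ k)) ⟩
        q * D' * D' * M * (r * m') - γ * u * u * q * q * W * (m' * K) * (D' * D' * M)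
          ≡⟨ factor q D' m' M r (γ * u * u * q * q * W) K ⟩
        Q * (D' * D' * (m' * M)) ∎
        where
          open ≡-Reasoning
          regroup : ∀ q D M E γ x u W →
                    q * (D * D * M) - D * E * γ * (x * x * x) * (u * q * (D * M)) - γ * ((u * q * (D * M)) * (u * q * (D * M))) * W
                    ≡ q * D * D * M * (1ℤ - E * γ * (x * x * x) * u) - γ * u * u * q * q * W * M * (D * D * M)
          regroup = solve-∀
          factor : ∀ q D m M r A K → q * D * D * M * (r * m) - A * (m * K) * (D * D * M) ≡ (q * r - A * K) * (D * D * (m * M))
          factor = solve-∀

      γx'⁴≈c : γ * (x + h) ⁴ ≈ c [mod D ℕ.* D ℕ.* m ^ suc (suc k) ]
      γx'⁴≈c = ≈-sym (divides-difference (divides Q (trans c-γx'⁴ (cong (Q *_) (sym cast₃)))))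

  hensel : γ ≈ c [mod D ℕ.* D ℕ.* m ] →
           Σ (ℤₚ m) λ x → (∀ k → γ * (+ res x k) ⁴ ≈ c [mod m ^ k ]) × + res x 1 ≈ 1ℤ [mod m ]
  hensel γ≈c = fromCompatible m x compatible , solves , x₁≈1
    where
      approximations : Σ (ℕ → ℤ) λ x → (∀ k → Approximation k (x k)) × (∀ k → x (suc k) ≈ x k [mod D ℕ.* m ^ suc k ])
      approximations = iterate-with-invariant Approximation (λ k x' x → x' ≈ x [mod D ℕ.* m ^ suc k ]) start newton-step
        where start : Approximation 0 1ℤ
              start = ≈-trans (≈-reflexive (ℤ.*-identityʳ γ)) (≈-weaken (ℕ.∣-reflexive (cong (D ℕ.* D ℕ.*_) (ℕ.*-identityʳ m))) γ≈c)
                    , ≈-refl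

      x : ℕ → ℤ
      x = proj₁ approximations

      compatible : Compatible m x
      compatible k = ≈-weaken (ℕ.∣n⇒∣m*n D (ℕ.n∣m*n m)) (proj₂ (proj₂ approximations) k)

      solves : ∀ k → γ * (+ res (fromCompatible m x compatible) k) ⁴ ≈ c [mod m ^ k ]
      solves k = ≈-trans (*-congˡ γ (⁴-cong (res-fromCompatible m x compatible k)))
                         (≈-weaken (ℕ.∣n⇒∣m*n (D ℕ.* D) (ℕ.n∣m*n m)) (proj₁ (proj₁ (proj₂ approximations) k)))

      x₁≈1 : + res (fromCompatible m x compatible) 1 ≈ 1ℤ [mod m ]
      x₁≈1 = ≈-trans (≈-^1 (res-fromCompatible m x compatible 1)) (proj₂ (proj₁ (proj₂ approximations) 1))

-- The form z₁⁴ + z₂⁴ + 3z₃⁴ + 5z₄⁴ + 7z₅⁴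

coefficient : Fin 5 → ℤ
coefficient 0F = 1ℤ
coefficient 1F = 1ℤ
coefficient 2F = + 3
coefficient 3F = + 5
coefficient 4F = + 7

diagonal : (Fin 5 → ℤ) → ℤ
diagonal v = sum λ i → coefficient i * v i ⁴

form≡diagonal : ∀ {p} (z : Fin 5 → ℤₚ p) k → form z k ≡ diagonal (λ i → + res (z i) k)
form≡diagonal z k = as-sum (r 0F) (r 1F) (r 2F) (r 3F) (r 4F)
  where
    r : Fin 5 → ℤ
    r i = + res (z i) k
    as-sum : ∀ a b c d e →
             a * a * a * a + b * b * b * b + + 3 * (c * c * c * c) + + 5 * (d * d * d * d) + + 7 * (e * e * e * e)
             ≡ 1ℤ * (a * a * a * a) + (1ℤ * (b * b * b * b) + (+ 3 * (c * c * c * c) + (+ 5 * (d * d * d * d) + (+ 7 * (e * e * e * e) + 0ℤ))))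
    as-sum = solve-∀

sum-cong : ∀ {m n} {f g : Fin n → ℤ} → (∀ i → f i ≈ g i [mod m ]) → sum f ≈ sum g [mod m ]
sum-cong {n = zero}  f≈g = ≈-refl
sum-cong {n = suc n} f≈g = +-cong (f≈g zero) (sum-cong (f≈g ∘ suc))

diagonal-cong : ∀ {m v w} → (∀ i → v i ≈ w i [mod m ]) → diagonal v ≈ diagonal w [mod m ]
diagonal-cong v≈w = sum-cong λ i → *-congˡ (coefficient i) (⁴-cong (v≈w i))

diagonal-without : Fin 5 → (Fin 5 → ℤ) → ℤ
diagonal-without i v = sum (removeAt (λ j → coefficient j * v j ⁴) i)

diagonal-updateAt : ∀ v i x → diagonal (updateAt v i (const x)) ≡ coefficient i * x ⁴ + diagonal-without i v
diagonal-updateAt v i x = begin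
  diagonal (updateAt v i (const x))
    ≡⟨ sum-remove {i = i} (λ j → coefficient j * updateAt v i (const x) j ⁴) ⟩
  coefficient i * updateAt v i (const x) i ⁴ + sum (removeAt (λ j → coefficient j * updateAt v i (const x) j ⁴) i)
    ≡⟨ cong₂ _+_ (cong (λ y → coefficient i * y ⁴) (updateAt-updates i {const x} v))
                 (sum-cong-≗ λ j → cong (λ y → coefficient (punchIn i j) * y ⁴) (updateAt-minimal (punchIn i j) i {const x} v (punchInᵢ≢i i j))) ⟩
  coefficient i * x ⁴ + diagonal-without i v ∎
  where open ≡-Reasoning

Solution : ℕ → ℤ → Set
Solution p a = Σ (Fin 5 → ℤₚ p) λ z → Solves z a × Σ (Fin 5) λ i → ¬ IsZero (z i)

solution-from-lift : ∀ m i (w : Fin 5 → ℤₚ m) n → (∀ j k → + res (w j) k ≈ n j [mod m ^ k ]) →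
                     ∀ (x : ℤₚ m) {a} → (∀ k → coefficient i * (+ res x k) ⁴ ≈ a - diagonal-without i n [mod m ^ k ]) →
                     ¬ IsZero x → Solution m a
solution-from-lift m i w n w≈n x {a} x-solves x≢0 = z , solves , i , x≢0 ∘ subst IsZero zᵢ≡x
  where
    z : Fin 5 → ℤₚ m
    z = updateAt w i (const x)

    zᵢ≡x : z i ≡ x
    zᵢ≡x = updateAt-updates i w

    residues : ∀ k j → + res (z j) k ≈ updateAt n i (const (+ res x k)) j [mod m ^ k ]
    residues k j with j Fin.≟ i
    ... | yes refl = ≈-reflexive (trans (cong (λ y → + res y k) zᵢ≡x) (sym (updateAt-updates i n)))
    ... | no j≢i = begin
      + res (z j) k                      ≡⟨ cong (λ y → + res y k) (updateAt-minimal j i w j≢i) ⟩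
      + res (w j) k                      ≈⟨ w≈n j k ⟩
      n j                                ≡⟨ updateAt-minimal j i n j≢i ⟨
      updateAt n i (const (+ res x k)) j ∎
      where open ≈-Reasoning (m ^ k)

    solves : Solves z a
    solves k = ≈⇒≡[mod] (begin
      form z k                                       ≡⟨ form≡diagonal z k ⟩
      diagonal (λ j → + res (z j) k)                 ≈⟨ diagonal-cong (residues k) ⟩
      diagonal (updateAt n i (const (+ res x k)))    ≡⟨ diagonal-updateAt n i (+ res x k) ⟩
      coefficient i * (+ res x k) ⁴ + diagonal-without i n ≈⟨ +-congʳ (diagonal-without i n) (x-solves k) ⟩
      a - diagonal-without i n + diagonal-without i n ≡⟨ sub-add a (diagonal-without i n) ⟩
      a                                              ∎)
      where open ≈-Reasoning (m ^ k)
            sub-add : ∀ a r → a - r + r ≡ a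
            sub-add = solve-∀

solution-from-seed : ∀ m .{{_ : NonZero m}} → ¬ 1ℤ ≈ 0ℤ [mod m ] → ∀ D {E u a} i n →
                     + D * E ≡ + 4 → E * coefficient i * u ≈ 1ℤ [mod m ] →
                     diagonal (updateAt n i (const 1ℤ)) ≈ a [mod D ℕ.* D ℕ.* m ] → Solution m a
solution-from-seed m 1≉0 D {a = a} i n D*E≡4 unit seed = lift (hensel m D D*E≡4 unit γ≈c)
  where
    γ≈c : coefficient i ≈ a - diagonal-without i n [mod D ℕ.* D ℕ.* m ]
    γ≈c = begin
      coefficient i                                              ≡⟨ add-sub (coefficient i) (diagonal-without i n) ⟩
      coefficient i * 1ℤ ⁴ + diagonal-without i n - diagonal-without i n ≡⟨ cong (_- diagonal-without i n) (diagonal-updateAt n i 1ℤ) ⟨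
      diagonal (updateAt n i (const 1ℤ)) - diagonal-without i n  ≈⟨ -‿congʳ (diagonal-without i n) seed ⟩
      a - diagonal-without i n                                   ∎
      where open ≈-Reasoning (D ℕ.* D ℕ.* m)
            add-sub : ∀ γ r → γ ≡ γ * (1ℤ * 1ℤ * 1ℤ * 1ℤ) + r - r
            add-sub = solve-∀

    lift : Σ (ℤₚ m) (λ x → (∀ k → coefficient i * (+ res x k) ⁴ ≈ a - diagonal-without i n [mod m ^ k ]) ×
                           + res x 1 ≈ 1ℤ [mod m ]) →
           Solution m a
    lift (x , x-solves , x₁≈1) =
      solution-from-lift m i (fromℤ m ∘ n) n (res-fromℤ m ∘ n) x x-solves (≉0⇒¬IsZero m x x₁≈1 1≉0)

-- Local solutions

odd-coefficient : ℕ → ℤ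
odd-coefficient 0 = 1ℤ
odd-coefficient 1 = + 3
odd-coefficient 2 = + 5
odd-coefficient _ = + 7

module _ {p : ℕ} (p-prime : Prime p) (2<p : 2 < p) where

  private instance
    p-nonZero : NonZero p
    p-nonZero = prime⇒nonZero p-prime

  odd-prime-solution : (∀ t → Represented p-prime (prefix odd-coefficient 4) t) → ∀ a → Solution p a
  odd-prime-solution represented a =
    solution-from-seed p 1≉0 1 {E = + 4} 0F n refl (proj₂ (inverse p-prime 4≉0))
                       (≈-weaken (ℕ.∣-reflexive (ℕ.*-identityˡ p)) seed)
    where
      1≉0 : ¬ 1ℤ ≈ 0ℤ [mod p ]
      1≉0 = nonzero-residue (s≤s z≤n) (ℕ.<-trans (s≤s (s≤s z≤n)) 2<p)

      4≉0 : ¬ + 4 ≈ 0ℤ [mod p ]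
      4≉0 4≈0 = [ two≉0 , two≉0 ]′ (≈0-product p-prime (+ 2) (+ 2) 4≈0)
        where two≉0 : ¬ + 2 ≈ 0ℤ [mod p ]
              two≉0 = nonzero-residue (s≤s z≤n) 2<p

      r : Represented p-prime (prefix odd-coefficient 4) (a - 1ℤ)
      r = represented (a - 1ℤ)

      x₇ x₅ x₃ x₁ : ℤ
      x₇ = + toℕ (proj₁ r)
      x₅ = + toℕ (proj₁ (proj₂ r))
      x₃ = + toℕ (proj₁ (proj₂ (proj₂ r)))
      x₁ = + toℕ (proj₁ (proj₂ (proj₂ (proj₂ r))))

      n : Fin 5 → ℤ
      n = 0ℤ Vector.∷ x₁ Vector.∷ x₃ Vector.∷ x₅ Vector.∷ x₇ Vector.∷ Vector.[]

      seed : diagonal (updateAt n 0F (const 1ℤ)) ≈ a [mod p ]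
      seed = begin
        diagonal (updateAt n 0F (const 1ℤ))
          ≡⟨ regroup a x₁ x₃ x₅ x₇ ⟩
        a - ((((a - 1ℤ - + 7 * x₇ ⁴) - + 5 * x₅ ⁴) - + 3 * x₃ ⁴) - 1ℤ * x₁ ⁴)
          ≈⟨ -‿congˡ a (proj₂ (proj₂ (proj₂ (proj₂ r)))) ⟩
        a - 0ℤ
          ≡⟨ ℤ.+-identityʳ a ⟩
        a ∎
        where
          open ≈-Reasoning p
          regroup : ∀ a w z y x →
                    1ℤ * (1ℤ * 1ℤ * 1ℤ * 1ℤ) + (1ℤ * (w * w * w * w) + (+ 3 * (z * z * z * z) + (+ 5 * (y * y * y * y) + (+ 7 * (x * x * x * x) + 0ℤ))))
                    ≡ a - ((((a - 1ℤ - + 7 * (x * x * x * x)) - + 5 * (y * y * y * y)) - + 3 * (z * z * z * z)) - 1ℤ * (w * w * w * w))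
          regroup = solve-∀

  small-odd-prime-solution : {_ : True (all? λ (r : Fin p) → represented? p-prime (prefix odd-coefficient 4) (+ toℕ r))} →
                             ∀ a → Solution p a
  small-odd-prime-solution {all-represented} =
    odd-prime-solution (represented-by-residues p-prime (prefix odd-coefficient 4) (toWitness all-represented))

  large-prime-solution : 7 < p → ∀ a → Solution p a
  large-prime-solution 7<p = odd-prime-solution (every-residue-represented p-prime odd-coefficient units 5<p)
    where
      5<p : 5 < p
      5<p = ℕ.<-trans (ℕ.n<1+n 5) (ℕ.<-trans (ℕ.n<1+n 6) 7<p)
      units : ∀ j → j < 4 → ¬ odd-coefficient j ≈ 0ℤ [mod p ]
      units 0 _ = nonzero-residue (s≤s z≤n) (ℕ.<-trans (s≤s (s≤s z≤n)) 2<p)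
      units 1 _ = nonzero-residue (s≤s z≤n) (ℕ.<-trans (ℕ.m≤m+n 4 3) 7<p)
      units 2 _ = nonzero-residue (s≤s z≤n) (ℕ.<-trans (ℕ.m≤m+n 6 1) 7<p)
      units 3 _ = nonzero-residue (s≤s z≤n) 7<p
      units (suc (suc (suc (suc _)))) (s≤s (s≤s (s≤s (s≤s ()))))

-- Entry r: an index i and a vector, with i-th entry 1, at which the form is ≡ r (mod 32).
two-adic-seeds : Vec (Fin 5 × Vec ℕ 5) 32
two-adic-seeds =
  (0F , 1 ∷ 0 ∷ 1 ∷ 1 ∷ 3 ∷ []) ∷ (0F , 1 ∷ 0 ∷ 0 ∷ 0 ∷ 0 ∷ []) ∷
  (0F , 1 ∷ 1 ∷ 0 ∷ 0 ∷ 0 ∷ []) ∷ (2F , 0 ∷ 0 ∷ 1 ∷ 0 ∷ 0 ∷ []) ∷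
  (0F , 1 ∷ 0 ∷ 1 ∷ 0 ∷ 0 ∷ []) ∷ (0F , 1 ∷ 1 ∷ 1 ∷ 0 ∷ 0 ∷ []) ∷
  (0F , 1 ∷ 0 ∷ 0 ∷ 1 ∷ 0 ∷ []) ∷ (0F , 1 ∷ 1 ∷ 0 ∷ 1 ∷ 0 ∷ []) ∷
  (0F , 1 ∷ 0 ∷ 0 ∷ 0 ∷ 1 ∷ []) ∷ (0F , 1 ∷ 0 ∷ 1 ∷ 1 ∷ 0 ∷ []) ∷
  (0F , 1 ∷ 1 ∷ 1 ∷ 1 ∷ 0 ∷ []) ∷ (0F , 1 ∷ 0 ∷ 1 ∷ 0 ∷ 1 ∷ []) ∷
  (0F , 1 ∷ 1 ∷ 1 ∷ 0 ∷ 1 ∷ []) ∷ (0F , 1 ∷ 0 ∷ 0 ∷ 1 ∷ 1 ∷ []) ∷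
  (0F , 1 ∷ 1 ∷ 0 ∷ 1 ∷ 1 ∷ []) ∷ (2F , 0 ∷ 0 ∷ 1 ∷ 1 ∷ 1 ∷ []) ∷
  (0F , 1 ∷ 0 ∷ 1 ∷ 1 ∷ 1 ∷ []) ∷ (0F , 1 ∷ 0 ∷ 0 ∷ 0 ∷ 2 ∷ []) ∷
  (0F , 1 ∷ 1 ∷ 0 ∷ 0 ∷ 2 ∷ []) ∷ (2F , 0 ∷ 0 ∷ 1 ∷ 0 ∷ 2 ∷ []) ∷
  (0F , 1 ∷ 0 ∷ 1 ∷ 0 ∷ 2 ∷ []) ∷ (0F , 1 ∷ 1 ∷ 1 ∷ 0 ∷ 2 ∷ []) ∷
  (0F , 1 ∷ 0 ∷ 0 ∷ 1 ∷ 2 ∷ []) ∷ (0F , 1 ∷ 1 ∷ 0 ∷ 1 ∷ 2 ∷ []) ∷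
  (0F , 1 ∷ 0 ∷ 0 ∷ 0 ∷ 3 ∷ []) ∷ (0F , 1 ∷ 0 ∷ 1 ∷ 1 ∷ 2 ∷ []) ∷
  (0F , 1 ∷ 1 ∷ 1 ∷ 1 ∷ 2 ∷ []) ∷ (0F , 1 ∷ 0 ∷ 1 ∷ 0 ∷ 3 ∷ []) ∷
  (0F , 1 ∷ 1 ∷ 1 ∷ 0 ∷ 3 ∷ []) ∷ (0F , 1 ∷ 0 ∷ 0 ∷ 1 ∷ 3 ∷ []) ∷
  (0F , 1 ∷ 1 ∷ 0 ∷ 1 ∷ 3 ∷ []) ∷ (2F , 0 ∷ 0 ∷ 1 ∷ 1 ∷ 3 ∷ []) ∷ []

seed-index : Fin 32 → Fin 5
seed-index r = proj₁ (lookup two-adic-seeds r)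

seed-vector : Fin 32 → Fin 5 → ℤ
seed-vector r = +_ ∘ lookup (proj₂ (lookup two-adic-seeds r))

two-adic-seeds-correct : ∀ r → diagonal (updateAt (seed-vector r) (seed-index r) (const 1ℤ)) ≈ + toℕ r [mod 32 ]
two-adic-seeds-correct =
  toWitness {a? = all? λ r → diagonal (updateAt (seed-vector r) (seed-index r) (const 1ℤ)) ≈? + toℕ r [mod 32 ]} _

odd-coefficients-square-to-1 : ∀ i → 1ℤ * coefficient i * coefficient i ≈ 1ℤ [mod 2 ]
odd-coefficients-square-to-1 = toWitness {a? = all? λ i → 1ℤ * coefficient i * coefficient i ≈? 1ℤ [mod 2 ]} _

two-adic-solution : ∀ a → Solution 2 a
two-adic-solution a =
  solution-from-seed 2 (nonzero-residue (s≤s z≤n) (s≤s (s≤s z≤n))) 4 {E = 1ℤ} (seed-index r) (seed-vector r) refl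
                     (odd-coefficients-square-to-1 (seed-index r)) (≈-trans (two-adic-seeds-correct r) r≈a)
  where
    r : Fin 32
    r = fromℕ< (n%ℕd<d a 32)
    r≈a : + toℕ r ≈ a [mod 32 ]
    r≈a = subst (λ t → + t ≈ a [mod 32 ]) (sym (toℕ-fromℕ< (n%ℕd<d a 32))) (%ℕ-≈ a 32)

lemma7p4 : (p : ℕ) → Prime p → (a : ℤ) →
    Σ (Fin 5 → ℤₚ p) (λ z → Solves z a × Σ (Fin 5) (λ i → ¬ IsZero (z i)))
lemma7p4 0 ()
lemma7p4 1 ()
lemma7p4 2 _ = two-adic-solution
lemma7p4 3 3-prime = small-odd-prime-solution 3-prime (ℕ.m≤m+n 3 0)
lemma7p4 4 4-prime = ⊥-elim (composite⇒¬prime composite[4] 4-prime)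
lemma7p4 5 5-prime = small-odd-prime-solution 5-prime (ℕ.m≤m+n 3 2)
lemma7p4 6 6-prime = ⊥-elim (composite⇒¬prime composite[6] 6-prime)
lemma7p4 7 7-prime = small-odd-prime-solution 7-prime (ℕ.m≤m+n 3 4)
lemma7p4 p@(suc (suc (suc (suc (suc (suc (suc (suc k)))))))) p-prime =
  large-prime-solution p-prime (ℕ.m≤m+n 3 (5 ℕ.+ k)) (ℕ.m≤m+n 8 k)
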